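{- Let $G$ be a graph, let $u,v$ be vertices of $\mathrm{core}(G)$, and let $C$ and $C'$ be the colorings produced by color refinement run on $G$ and on $\mathrm{core}(G)$ respectively. If $C'(u)\neq C'(v)$, then $C(u)\neq C(v)$.
   Context: The core $\mathrm{core}(G)$ is the maximal subgraph of $G$ of minimum degree at least $2$. Color refinement on a graph: starting from a uniform coloring, iteratively set $C_i(x)=(C_{i-1}(x),\{\!\{C_{i-1}(y):y\in N(x)\}\!\})$ until the color partition stabilizes, giving the output coloring. -}

module Defs where

open import Data.Bool using (Bool; true; false; _∧_; _∨_; not)
open import Data.Nat using (ℕ; zero; suc; _+_; _≤_; _≡ᵇ_)
open import Data.Fin using (Fin)
import Data.Fin as F
open import Data.Product using (_×_)
open import Relation.Binary.PropositionalEquality using (_≡_)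

record Graph (n : ℕ) : Set where
  field
    adj     : Fin n → Fin n → Bool
    symm    : ∀ x y → adj x y ≡ adj y x
    irrefl  : ∀ x → adj x x ≡ false
open Graph public

b2n : Bool → ℕ
b2n true  = 1
b2n false = 0

countV : {n : ℕ} → (Fin n → Bool) → ℕ
countV {zero}  p = 0
countV {suc n} p = b2n (p F.zero) + countV (λ i → p (F.suc i))

allV : {n : ℕ} → (Fin n → Bool) → Bool
allV {zero}  p = true
allV {suc n} p = p F.zero ∧ allV (λ i → p (F.suc i))

VSet : ℕ → Set
VSet n = Fin n → Bool

fullSet : {n : ℕ} → VSet n
fullSet _ = true

_⊆_ : {n : ℕ} → VSet n → VSet n → Set
S ⊆ T = ∀ x → S x ≡ true → T x ≡ true

degIn : {n : ℕ} → Graph n → VSet n → Fin n → ℕ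
degIn G S x = countV (λ y → S y ∧ adj G x y)

MinDeg2 : {n : ℕ} → Graph n → VSet n → Set
MinDeg2 G S = ∀ x → S x ≡ true → 2 ≤ degIn G S x

IsCore : {n : ℕ} → Graph n → VSet n → Set
IsCore G S = MinDeg2 G S × (∀ T → MinDeg2 G T → T ⊆ S)

-- Color refinement on the induced subgraph G[S].
-- sameColor G S i x y = true  iff  C_i(x) = C_i(y)  (for x, y ∈ S).
-- C_0 is uniform; C_{i+1}(x) = C_{i+1}(y) iff C_i(x) = C_i(y) and the multisets
-- {{C_i(w) : w ∈ N(x)}} and {{C_i(w) : w ∈ N(y)}} are equal, i.e. every color
-- (the color of some vertex z ∈ S) has the same multiplicity in both.
sameColor : {n : ℕ} → Graph n → VSet n → ℕ → Fin n → Fin n → Bool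
sameColor G S zero    x y = true
sameColor G S (suc i) x y =
  sameColor G S i x y ∧
  allV (λ z → not (S z) ∨
    (countV (λ w → S w ∧ adj G x w ∧ sameColor G S i w z)
      ≡ᵇ countV (λ w → S w ∧ adj G y w ∧ sameColor G S i w z)))

Stable : {n : ℕ} → Graph n → VSet n → ℕ → Set
Stable G S i = ∀ x y → S x ≡ true → S y ≡ true →
  sameColor G S (suc i) x y ≡ sameColor G S i x y

-- Let R be the stable colouring of G. Stability means R-equivalent vertices have
-- equally many neighbours in every R-class, hence in every union of R-classes. So
-- the union of the R-classes meeting core(G) has minimum degree at least 2; by
-- maximality of the core it is core(G) itself. Refinement inside core(G) therefore
-- only ever counts neighbours in unions of R-classes, and by induction on the
-- rounds it never separates two R-equivalent vertices.
module Submission where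

open import Defs
open import Algebra.Bundles using (CommutativeMonoid)
open import Data.Bool using (Bool; true; false; _∧_; _∨_; not)
open import Data.Bool.Properties
  using ( ∧-assoc; ∧-comm; ∧-identityʳ; ∧-zeroʳ; ∧-conicalˡ; ∧-conicalʳ; ∧-commutativeMonoid
        ; T-≡; ⇔→≡)
open import Data.Fin using (Fin)
import Data.Fin as F
open import Data.Nat using (ℕ; zero; suc; _+_; _≤_; _<_; _≡ᵇ_; z≤n; s≤s)
open import Data.Nat.Properties
  using ( +-suc; ≤-refl; ≤-pred; <-≤-trans; m≤n⇒m≤1+n; m≤n+m; m<n+m; ≡ᵇ⇒≡; ≡⇒≡ᵇ
        ; module ≤-Reasoning)
open import Data.Product using (Σ; _×_; _,_; proj₂)
open import Function.Bundles using (Equivalence; mk⇔)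
open import Relation.Binary.Structures using (IsEquivalence)
open import Relation.Binary.PropositionalEquality
open import Algebra.Properties.CommutativeSemigroup
  (CommutativeMonoid.commutativeSemigroup ∧-commutativeMonoid) using (x∙yz≈y∙xz)

variable
  n : ℕ

≡ᵇ-true⇒≡ : ∀ m k → (m ≡ᵇ k) ≡ true → m ≡ k
≡ᵇ-true⇒≡ m k e = ≡ᵇ⇒≡ m k (Equivalence.from T-≡ e)

≡⇒≡ᵇ-true : ∀ m k → m ≡ k → (m ≡ᵇ k) ≡ true
≡⇒≡ᵇ-true m k e = Equivalence.to T-≡ (≡⇒≡ᵇ m k e)

not-∨⁺ : ∀ a {b} → (a ≡ true → b ≡ true) → not a ∨ b ≡ true
not-∨⁺ true  h = h refl
not-∨⁺ false h = refl

not-∨⁻ : ∀ a {b} → not a ∨ b ≡ true → a ≡ true → b ≡ true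
not-∨⁻ true e refl = e

≡true-contrapositive : ∀ {a b} → (a ≡ true → b ≡ true) → b ≡ false → a ≡ false
≡true-contrapositive {false} h e = refl
≡true-contrapositive {true}  h e with () ← trans (sym (h refl)) e

_∩_ : VSet n → VSet n → VSet n
(P ∩ Q) x = P x ∧ Q x

∁ : VSet n → VSet n
∁ P x = not (P x)

anyV : (Fin n → Bool) → Bool
anyV {zero}  p = false
anyV {suc n} p = p F.zero ∨ anyV (λ i → p (F.suc i))

anyV-witness : (p : Fin n → Bool) → anyV p ≡ true → Σ (Fin n) (λ z → p z ≡ true)
anyV-witness {suc n} p e with p F.zero in p0
... | true  = F.zero , p0
... | false with anyV-witness (λ i → p (F.suc i)) e
...   | z , pz = F.suc z , pz

anyV-false : (p : Fin n → Bool) → anyV p ≡ false → ∀ x → p x ≡ false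
anyV-false {suc n} p e x with p F.zero in p0
anyV-false {suc n} p () x         | true
anyV-false {suc n} p e F.zero     | false = p0
anyV-false {suc n} p e (F.suc x)  | false = anyV-false (λ i → p (F.suc i)) e x

anyV-intro : (p : Fin n → Bool) (z : Fin n) → p z ≡ true → anyV p ≡ true
anyV-intro {suc n} p F.zero    e rewrite e = refl
anyV-intro {suc n} p (F.suc z) e with p F.zero
... | true  = refl
... | false = anyV-intro (λ i → p (F.suc i)) z e

anyV-cong : (p q : Fin n → Bool) → (∀ x → p x ≡ q x) → anyV p ≡ anyV q
anyV-cong {zero}  p q e = refl
anyV-cong {suc n} p q e =
  cong₂ _∨_ (e F.zero) (anyV-cong (λ i → p (F.suc i)) (λ i → q (F.suc i)) (λ i → e (F.suc i)))

allV-elim : (p : Fin n → Bool) → allV p ≡ true → ∀ x → p x ≡ true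
allV-elim {suc n} p e F.zero    = ∧-conicalˡ _ _ e
allV-elim {suc n} p e (F.suc x) = allV-elim (λ i → p (F.suc i)) (∧-conicalʳ _ _ e) x

allV-intro : (p : Fin n → Bool) → (∀ x → p x ≡ true) → allV p ≡ true
allV-intro {zero}  p h = refl
allV-intro {suc n} p h = cong₂ _∧_ (h F.zero) (allV-intro _ (λ i → h (F.suc i)))

countV-cong : (p q : Fin n → Bool) → (∀ x → p x ≡ q x) → countV p ≡ countV q
countV-cong {zero}  p q e = refl
countV-cong {suc n} p q e =
  cong₂ _+_ (cong b2n (e F.zero)) (countV-cong (λ i → p (F.suc i)) (λ i → q (F.suc i)) (λ i → e (F.suc i)))

countV-false : countV {n} (λ _ → false) ≡ 0
countV-false {zero}  = refl
countV-false {suc n} = countV-false {n}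

countV-split : (P Q : VSet n) → countV P ≡ countV (P ∩ Q) + countV (P ∩ ∁ Q)
countV-split {zero}  P Q = refl
countV-split {suc n} P Q with P F.zero | Q F.zero | countV-split (λ i → P (F.suc i)) (λ i → Q (F.suc i))
... | true  | true  | ih = cong suc ih
... | true  | false | ih = trans (cong suc ih) (sym (+-suc _ _))
... | false | true  | ih = ih
... | false | false | ih = ih

countV-mono : (P Q : VSet n) → P ⊆ Q → countV P ≤ countV Q
countV-mono {zero}  P Q h = z≤n
countV-mono {suc n} P Q h
  with P F.zero | Q F.zero | h F.zero | countV-mono (λ i → P (F.suc i)) (λ i → Q (F.suc i)) (λ i → h (F.suc i))
... | true  | true  | _  | ih = s≤s ih
... | true  | false | h0 | ih with () ← h0 refl
... | false | true  | _  | ih = m≤n⇒m≤1+n ih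
... | false | false | _  | ih = ih

countV-pos : (P : VSet n) (z : Fin n) → P z ≡ true → 0 < countV P
countV-pos {suc n} P F.zero    e rewrite e = s≤s z≤n
countV-pos {suc n} P (F.suc z) e = <-≤-trans (countV-pos (λ i → P (F.suc i)) z e) (m≤n+m _ _)

nbrCount : Graph n → Fin n → VSet n → ℕ
nbrCount G x P = countV (adj G x ∩ P)

nbrCount-cong : (G : Graph n) (x : Fin n) (P Q : VSet n) → (∀ w → P w ≡ Q w) → nbrCount G x P ≡ nbrCount G x Q
nbrCount-cong G x P Q e = countV-cong _ _ (λ w → cong (adj G x w ∧_) (e w))

nbrCount-mono : (G : Graph n) (x : Fin n) (P Q : VSet n) → P ⊆ Q → nbrCount G x P ≤ nbrCount G x Q
nbrCount-mono G x P Q P⊆Q =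
  countV-mono _ _ (λ w e → cong₂ _∧_ (∧-conicalˡ _ _ e) (P⊆Q w (∧-conicalʳ _ _ e)))

nbrCount-split : (G : Graph n) (x : Fin n) (P Q : VSet n) →
  nbrCount G x P ≡ nbrCount G x (P ∩ Q) + nbrCount G x (P ∩ ∁ Q)
nbrCount-split G x P Q =
  trans (countV-split (adj G x ∩ P) Q)
        (cong₂ _+_ (countV-cong _ _ (λ w → ∧-assoc (adj G x w) (P w) (Q w)))
                   (countV-cong _ _ (λ w → ∧-assoc (adj G x w) (P w) (not (Q w)))))

degIn≡nbrCount : (G : Graph n) (S : VSet n) (x : Fin n) → degIn G S x ≡ nbrCount G x S
degIn≡nbrCount G S x = countV-cong _ _ (λ y → ∧-comm (S y) (adj G x y))

IsBoolEquivalence : (Fin n → Fin n → Bool) → Set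
IsBoolEquivalence R = IsEquivalence (λ x y → R x y ≡ true)

classOf : (Fin n → Fin n → Bool) → Fin n → VSet n
classOf R z w = R w z

Saturated : (Fin n → Fin n → Bool) → VSet n → Set
Saturated R P = ∀ w w′ → R w w′ ≡ true → P w ≡ P w′

Equitable : Graph n → (Fin n → Fin n → Bool) → Set
Equitable G R = ∀ x y → R x y ≡ true → ∀ z → nbrCount G x (classOf R z) ≡ nbrCount G y (classOf R z)

class-saturated : {R : Fin n → Fin n → Bool} → IsBoolEquivalence R → ∀ z → Saturated R (classOf R z)
class-saturated isEq z w w′ r =
  ⇔→≡ (mk⇔ (≈-trans (≈-sym r)) (≈-trans r))
  where open IsEquivalence isEq renaming (sym to ≈-sym; trans to ≈-trans)

module _ (G : Graph n) (S : VSet n) where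

  colourCount : ℕ → Fin n → Fin n → ℕ
  colourCount i x z = countV (λ w → S w ∧ adj G x w ∧ sameColor G S i w z)

  colourCount≡nbrCount : ∀ i x z → colourCount i x z ≡ nbrCount G x (S ∩ λ w → sameColor G S i w z)
  colourCount≡nbrCount i x z = countV-cong _ _ (λ w → x∙yz≈y∙xz (S w) (adj G x w) _)

  sameColor-suc⁺ : ∀ i {x y} → sameColor G S i x y ≡ true →
    (∀ z → S z ≡ true → colourCount i x z ≡ colourCount i y z) → sameColor G S (suc i) x y ≡ true
  sameColor-suc⁺ i same counts =
    cong₂ _∧_ same (allV-intro _ (λ z → not-∨⁺ (S z) (λ Sz → ≡⇒≡ᵇ-true _ _ (counts z Sz))))

  sameColor-suc⁻ : ∀ i {x y} → sameColor G S (suc i) x y ≡ true →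
    sameColor G S i x y ≡ true × (∀ z → S z ≡ true → colourCount i x z ≡ colourCount i y z)
  sameColor-suc⁻ i e =
    ∧-conicalˡ _ _ e , λ z Sz → ≡ᵇ-true⇒≡ _ _ (not-∨⁻ (S z) (allV-elim _ (∧-conicalʳ _ _ e) z) Sz)

  sameColor-refl : ∀ i x → sameColor G S i x x ≡ true
  sameColor-refl zero    x = refl
  sameColor-refl (suc i) x = sameColor-suc⁺ i (sameColor-refl i x) (λ _ _ → refl)

  sameColor-sym : ∀ i {x y} → sameColor G S i x y ≡ true → sameColor G S i y x ≡ true
  sameColor-sym zero    e = refl
  sameColor-sym (suc i) e with same , counts ← sameColor-suc⁻ i e =
    sameColor-suc⁺ i (sameColor-sym i same) (λ z Sz → sym (counts z Sz))

  sameColor-trans : ∀ i {x y k} → sameColor G S i x y ≡ true → sameColor G S i y k ≡ true →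
    sameColor G S i x k ≡ true
  sameColor-trans zero    e f = refl
  sameColor-trans (suc i) e f
    with same₁ , counts₁ ← sameColor-suc⁻ i e | same₂ , counts₂ ← sameColor-suc⁻ i f =
    sameColor-suc⁺ i (sameColor-trans i same₁ same₂) (λ z Sz → trans (counts₁ z Sz) (counts₂ z Sz))

  sameColor-isEquivalence : ∀ i → IsBoolEquivalence (sameColor G S i)
  sameColor-isEquivalence i = record
    { refl  = sameColor-refl i _
    ; sym   = sameColor-sym i
    ; trans = sameColor-trans i
    }

stable⇒equitable : (G : Graph n) (t : ℕ) → Stable G fullSet t → Equitable G (sameColor G fullSet t)
stable⇒equitable G t stable x y e z =
  proj₂ (sameColor-suc⁻ G fullSet t (trans (stable x y refl refl) e)) z refl

module _ (G : Graph n) {R : Fin n → Fin n → Bool} (isEq : IsBoolEquivalence R) (equitable : Equitable G R) where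

  open IsEquivalence isEq using () renaming (refl to ≈-refl; sym to ≈-sym)

  countV-∖class< : (P : VSet n) → ∀ {z} → P z ≡ true → countV (P ∩ ∁ (classOf R z)) < countV P
  countV-∖class< P {z} Pz = begin-strict
    countV (P ∩ ∁ (classOf R z))
      <⟨ m<n+m _ (countV-pos _ z (cong₂ _∧_ Pz ≈-refl)) ⟩
    countV (P ∩ classOf R z) + countV (P ∩ ∁ (classOf R z))
      ≡⟨ countV-split P (classOf R z) ⟨
    countV P
      ∎
    where open ≤-Reasoning

  nbrCount-∩class : (P : VSet n) → Saturated R P → ∀ {z} → P z ≡ true → ∀ x →
    nbrCount G x (P ∩ classOf R z) ≡ nbrCount G x (classOf R z)
  nbrCount-∩class P sat {z} Pz x = nbrCount-cong G x _ _ inClass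
    where
    inClass : ∀ w → P w ∧ R w z ≡ R w z
    inClass w with R w z in wz
    ... | true  = trans (∧-identityʳ (P w)) (trans (sat w z wz) Pz)
    ... | false = ∧-zeroʳ (P w)

  nbrCount-saturated : (P : VSet n) → Saturated R P → ∀ {u v} → R u v ≡ true → nbrCount G u P ≡ nbrCount G v P
  nbrCount-saturated P = bounded (suc (countV P)) P ≤-refl
    where
    -- Peel off one R-class at a time; the bound k makes the recursion structural.
    bounded : ∀ k P → countV P < k → Saturated R P → ∀ {u v} → R u v ≡ true → nbrCount G u P ≡ nbrCount G v P
    bounded (suc k) P size sat {u} {v} uRv with anyV P in anyP
    ... | false = trans (empty u) (sym (empty v))
      where
      empty : ∀ x → nbrCount G x P ≡ 0
      empty x = trans (countV-cong _ _ (λ w → trans (cong (adj G x w ∧_) (anyV-false P anyP w)) (∧-zeroʳ _)))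
                      (countV-false {n})
    ... | true with z , Pz ← anyV-witness P anyP = begin
      nbrCount G u P
        ≡⟨ nbrCount-split G u P (classOf R z) ⟩
      nbrCount G u (P ∩ classOf R z) + nbrCount G u (P ∩ ∁ (classOf R z))
        ≡⟨ cong₂ _+_ inClass rest ⟩
      nbrCount G v (P ∩ classOf R z) + nbrCount G v (P ∩ ∁ (classOf R z))
        ≡⟨ nbrCount-split G v P (classOf R z) ⟨
      nbrCount G v P
        ∎
      where
      open ≡-Reasoning
      inClass : nbrCount G u (P ∩ classOf R z) ≡ nbrCount G v (P ∩ classOf R z)
      inClass = trans (nbrCount-∩class P sat Pz u)
                      (trans (equitable u v uRv z) (sym (nbrCount-∩class P sat Pz v)))
      rest : nbrCount G u (P ∩ ∁ (classOf R z)) ≡ nbrCount G v (P ∩ ∁ (classOf R z))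
      rest = bounded k (P ∩ ∁ (classOf R z)) (<-≤-trans (countV-∖class< P Pz) (≤-pred size))
               (λ w w′ r → cong₂ _∧_ (sat w w′ r) (cong not (class-saturated isEq z w w′ r))) uRv

  saturation : VSet n → VSet n
  saturation S w = anyV (λ w′ → S w′ ∧ R w w′)

  saturation-saturated : (S : VSet n) → Saturated R (saturation S)
  saturation-saturated S w w′ r = anyV-cong _ _ (λ w″ → cong (S w″ ∧_) (class-saturated isEq w″ w w′ r))

  ⊆-saturation : (S : VSet n) → S ⊆ saturation S
  ⊆-saturation S w Sw = anyV-intro _ w (cong₂ _∧_ Sw ≈-refl)

  saturation-minDeg2 : (S : VSet n) → MinDeg2 G S → MinDeg2 G (saturation S)
  saturation-minDeg2 S minDeg x Tx with w , Sw∧xRw ← anyV-witness _ Tx = begin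
    2                                ≤⟨ minDeg w (∧-conicalˡ _ _ Sw∧xRw) ⟩
    degIn G S w                      ≡⟨ degIn≡nbrCount G S w ⟩
    nbrCount G w S                   ≤⟨ nbrCount-mono G w S T (⊆-saturation S) ⟩
    nbrCount G w T                   ≡⟨ nbrCount-saturated T (saturation-saturated S) (∧-conicalʳ _ _ Sw∧xRw) ⟨
    nbrCount G x T                   ≡⟨ degIn≡nbrCount G T x ⟨
    degIn G T x                      ∎
    where
    open ≤-Reasoning
    T = saturation S

  core-saturated : (S : VSet n) → IsCore G S → Saturated R S
  core-saturated S (minDeg , maximal) w w′ r = ⇔→≡ (mk⇔ (closed r) (closed (≈-sym r)))
    where
    closed : ∀ {x y} → R x y ≡ true → S x ≡ true → S y ≡ true
    closed {x} {y} xRy Sx =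
      maximal (saturation S) (saturation-minDeg2 S minDeg) y (anyV-intro _ x (cong₂ _∧_ Sx (≈-sym xRy)))

  refines-sameColor : (S : VSet n) → Saturated R S → ∀ i {a b} → R a b ≡ true → sameColor G S i a b ≡ true
  refines-sameColor S satS zero    aRb = refl
  refines-sameColor S satS (suc i) {a} {b} aRb =
    sameColor-suc⁺ G S i (refines-sameColor S satS i aRb) (λ z _ → begin
      colourCount G S i a z        ≡⟨ colourCount≡nbrCount G S i a z ⟩
      nbrCount G a (colour z)      ≡⟨ nbrCount-saturated (colour z) (colour-saturated z) aRb ⟩
      nbrCount G b (colour z)      ≡⟨ colourCount≡nbrCount G S i b z ⟨
      colourCount G S i b z        ∎)
    where
    open ≡-Reasoning
    colour : Fin n → VSet n
    colour z = S ∩ λ w → sameColor G S i w z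
    colour-saturated : ∀ z → Saturated R (colour z)
    colour-saturated z w w′ r =
      cong₂ _∧_ (satS w w′ r)
                (class-saturated (sameColor-isEquivalence G S i) z w w′ (refines-sameColor S satS i r))

claim7 : {n : ℕ} (G : Graph n) (S : VSet n) → IsCore G S →
    (u v : _) → S u ≡ true → S v ≡ true →
    (t t′ : ℕ) → Stable G fullSet t → Stable G S t′ →
    sameColor G S t′ u v ≡ false → sameColor G fullSet t u v ≡ false
claim7 G S core u v _ _ t t′ stable _ =
  ≡true-contrapositive (refines-sameColor G isEq equitable S (core-saturated G isEq equitable S core) t′)
  where
  isEq : IsBoolEquivalence (sameColor G fullSet t)
  isEq = sameColor-isEquivalence G fullSet t
  equitable : Equitable G (sameColor G fullSet t)
  equitable = stable⇒equitable G t stable
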